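{- Let $m>0$ and $n\ge 0$ be integers. Then the diameter of ${\rm SR}(m,n)$ is $\min(m-1,n)$.
   Context: Let $\mathbb{N}$ denote the nonnegative integers. For $m,n\in\mathbb{N}$, the simplicial rook graph ${\rm SR}(m,n)$ has as vertices the vectors in $\mathbb{N}^m$ with coordinate sum $n$, two vertices being adjacent when they differ in precisely two coordinate positions. -}

module Defs where

open import Data.Nat using (ℕ; zero; suc; _+_; _≤_; _<_; _≟_)
open import Data.Vec using (Vec; []; _∷_; sum)
open import Data.Product using (Σ; ∃; ∃-syntax; _×_; _,_; proj₁)
open import Relation.Binary.PropositionalEquality using (_≡_)
open import Relation.Nullary using (¬_; yes; no)

-- Vertices of SR(m,n): vectors in ℕ^m with coordinate sum n.
Vertex : ℕ → ℕ → Set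
Vertex m n = Σ (Vec ℕ m) (λ v → sum v ≡ n)

hamming : ∀ {m} → Vec ℕ m → Vec ℕ m → ℕ
hamming [] [] = 0
hamming (x ∷ xs) (y ∷ ys) with x ≟ y
... | yes _ = hamming xs ys
... | no  _ = suc (hamming xs ys)

-- Adjacency in SR(m,n): differ in precisely two coordinate positions.
Adj : ∀ {m n} → Vertex m n → Vertex m n → Set
Adj u v = hamming (proj₁ u) (proj₁ v) ≡ 2

data Walk {m n : ℕ} : Vertex m n → Vertex m n → ℕ → Set where
  here : ∀ {u} → Walk u u 0
  step : ∀ {u w v k} → Adj u w → Walk w v k → Walk u v (suc k)

Dist : ∀ {m n} → Vertex m n → Vertex m n → ℕ → Set
Dist u v k = Walk u v k × (∀ j → j < k → ¬ Walk u v j)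

HasDiameter : ℕ → ℕ → ℕ → Set
HasDiameter m n d =
  (∀ (u v : Vertex m n) → ∃[ k ] (k ≤ d × Dist u v k)) ×
  (∃[ u ] ∃[ v ] Dist {m} {n} u v d)

module Submission where

-- Write h(a, b) for the Hamming distance and e(a, b) for the
-- excess Σ (aᵢ ∸ bᵢ), the mass a must shed to become b.  If a ≢ b have equal
-- sums, then one of them, say a, has a neighbour a' with h(a', b) < h(a, b) and
-- e(a', b) < e(a, b) ('approach'): at the first disagreement aᵢ > bᵢ, move
-- min(surplus, deficit) to the first later coordinate lying below b ('raise').
-- Iterating ('shortWalk') gives a walk of length ≤ h - 1 ≤ m' and ≤ e ≤ n.
-- SR(m, n) is finite, so walks of a given length are decidable and a shortest
-- walk exists ('distance'), which realises Dist.
--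
-- Let 'rises a b' count coordinates with aᵢ < bᵢ.  Along an edge
-- at most one coordinate rises, and support grows only at rising coordinates,
-- so the support of the tail (coordinates 2..m) grows by at most one per edge
-- ('walk-support').  Hence (n, 0, …, 0) and (n - d, 1, …, 1, 0, …, 0), with d
-- ones, are at distance ≥ d, and 'diameter' combines the two bounds.

open import Defs
open import Data.Nat using (ℕ; _∸_; _⊓_; _>_)
open import Data.Nat using (zero; suc; _+_; _≤_; _<_; _≟_; _<?_; _≤?_; z≤n; s≤s)
open import Data.Nat.Properties
open import Algebra.Properties.CommutativeSemigroup +-commutativeSemigroup using (interchange; x∙yz≈y∙xz)
open import Data.Fin using (Fin; toℕ; fromℕ<)
open import Data.Fin.Properties using (any?; toℕ≤pred[n]; toℕ-fromℕ<)
open import Data.Vec using (Vec; []; _∷_; sum; tail)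
import Data.Vec.Properties as Vec
open import Data.Product using (∃; ∃-syntax; _×_; _,_; proj₁)
open import Data.Sum using (_⊎_; inj₁; inj₂; map₁)
open import Function using (_∘_)
open import Relation.Binary.PropositionalEquality
open import Relation.Nullary using (¬_; yes; no; Dec; contradiction)
open import Relation.Nullary.Decidable using (_×-dec_; map′)
open import Relation.Binary.Definitions using (tri<; tri≈; tri>)

hamming-∷-≡ : ∀ {k} x (a b : Vec ℕ k) → hamming (x ∷ a) (x ∷ b) ≡ hamming a b
hamming-∷-≡ x a b with x ≟ x
... | yes _   = refl
... | no x≢x = contradiction refl x≢x

hamming-∷-≢ : ∀ {k x y} {a b : Vec ℕ k} → x ≢ y → hamming (x ∷ a) (y ∷ b) ≡ suc (hamming a b)
hamming-∷-≢ {x = x} {y} x≢y with x ≟ y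
... | yes x≡y = contradiction x≡y x≢y
... | no _    = refl

hamming-∷-≤ : ∀ {k} x y (a b : Vec ℕ k) → hamming (x ∷ a) (y ∷ b) ≤ suc (hamming a b)
hamming-∷-≤ x y a b with x ≟ y
... | yes _ = n≤1+n _
... | no _  = ≤-refl

hamming-∷-mono-≤ : ∀ {k} x y {a a' b : Vec ℕ k} →
                   hamming a' b ≤ hamming a b → hamming (x ∷ a') (y ∷ b) ≤ hamming (x ∷ a) (y ∷ b)
hamming-∷-mono-≤ x y le with x ≟ y
... | yes _ = le
... | no _  = s≤s le

hamming-∷-mono-< : ∀ {k} x y {a a' b : Vec ℕ k} →
                   hamming a' b < hamming a b → hamming (x ∷ a') (y ∷ b) < hamming (x ∷ a) (y ∷ b)
hamming-∷-mono-< x y lt with x ≟ y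
... | yes _ = lt
... | no _  = s≤s lt

hamming-sym : ∀ {k} (a b : Vec ℕ k) → hamming a b ≡ hamming b a
hamming-sym [] [] = refl
hamming-sym (x ∷ a) (y ∷ b) with x ≟ y | y ≟ x
... | yes _   | yes _   = hamming-sym a b
... | no _    | no _    = cong suc (hamming-sym a b)
... | yes x≡y | no y≢x  = contradiction (sym x≡y) y≢x
... | no x≢y  | yes y≡x = contradiction (sym y≡x) x≢y

hamming-refl : ∀ {k} (a : Vec ℕ k) → hamming a a ≡ 0
hamming-refl []      = refl
hamming-refl (x ∷ a) = trans (hamming-∷-≡ x a a) (hamming-refl a)

hamming≡0⇒≡ : ∀ {k} (a b : Vec ℕ k) → hamming a b ≡ 0 → a ≡ b
hamming≡0⇒≡ [] [] _ = refl
hamming≡0⇒≡ (x ∷ a) (y ∷ b) h with x ≟ y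
... | yes refl = cong (x ∷_) (hamming≡0⇒≡ a b h)

hamming-pos : ∀ {k} {a b : Vec ℕ k} → a ≢ b → 1 ≤ hamming a b
hamming-pos {a = a} {b} a≢b = n≢0⇒n>0 (a≢b ∘ hamming≡0⇒≡ a b)

hamming≤length : ∀ {k} (a b : Vec ℕ k) → hamming a b ≤ k
hamming≤length [] [] = z≤n
hamming≤length (x ∷ a) (y ∷ b) = ≤-trans (hamming-∷-≤ x y a b) (s≤s (hamming≤length a b))

excess : ∀ {k} → Vec ℕ k → Vec ℕ k → ℕ
excess []      []      = 0
excess (x ∷ a) (y ∷ b) = (x ∸ y) + excess a b

excess≤sum : ∀ {k} (a b : Vec ℕ k) → excess a b ≤ sum a
excess≤sum []      []      = z≤n
excess≤sum (x ∷ a) (y ∷ b) = +-mono-≤ (m∸n≤m x y) (excess≤sum a b)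

-- Both sides equal max(x, y).
truncated-balance : ∀ x y → (x ∸ y) + y ≡ (y ∸ x) + x
truncated-balance zero    zero    = refl
truncated-balance zero    (suc y) = sym (+-identityʳ (suc y))
truncated-balance (suc x) zero    = cong suc (+-identityʳ x)
truncated-balance (suc x) (suc y) =
  trans (+-suc (x ∸ y) y) (trans (cong suc (truncated-balance x y)) (sym (+-suc (y ∸ x) x)))

excess-balance : ∀ {k} (a b : Vec ℕ k) → excess a b + sum b ≡ excess b a + sum a
excess-balance [] [] = refl
excess-balance (x ∷ a) (y ∷ b) = begin
  (x ∸ y) + excess a b + (y + sum b)   ≡⟨ interchange (x ∸ y) (excess a b) y (sum b) ⟩
  ((x ∸ y) + y) + (excess a b + sum b) ≡⟨ cong₂ _+_ (truncated-balance x y) (excess-balance a b) ⟩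
  ((y ∸ x) + x) + (excess b a + sum a) ≡⟨ interchange (y ∸ x) x (excess b a) (sum a) ⟩
  (y ∸ x) + excess b a + (x + sum a)   ∎
  where open ≡-Reasoning

excess-sym : ∀ {k} (a b : Vec ℕ k) → sum a ≡ sum b → excess a b ≡ excess b a
excess-sym a b eq =
  +-cancelʳ-≡ _ (excess a b) (excess b a) (trans (excess-balance a b) (cong (excess b a +_) eq))

record Raise {k} (a b : Vec ℕ k) (e : ℕ) : Set where
  field
    δ             : ℕ
    raised        : Vec ℕ k
    1≤δ           : 1 ≤ δ
    δ≤e           : δ ≤ e
    single-change : hamming a raised ≡ 1
    sum-raised    : sum raised ≡ δ + sum a
    excess-kept   : excess raised b ≡ excess a b
    hamming-kept  : hamming raised b ≤ hamming a b
    fixed-or-full : hamming raised b < hamming a b ⊎ δ ≡ e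

-- If a is below b in total, some coordinate is below b and can be raised: the
-- first one, by min(e, gap).
raise : ∀ {k} (a b : Vec ℕ k) (e : ℕ) → sum a < sum b → 1 ≤ e → Raise a b e
raise [] [] e () _
raise (p ∷ a) (q ∷ b) e lt 1≤e with p <? q
... | no p≮q = record
  { δ             = δ
  ; raised        = p ∷ raised
  ; 1≤δ           = 1≤δ
  ; δ≤e           = δ≤e
  ; single-change = trans (hamming-∷-≡ p a raised) single-change
  ; sum-raised    = trans (cong (p +_) sum-raised) (x∙yz≈y∙xz p δ (sum a))
  ; excess-kept   = cong ((p ∸ q) +_) excess-kept
  ; hamming-kept  = hamming-∷-mono-≤ p q hamming-kept
  ; fixed-or-full = map₁ (hamming-∷-mono-< p q) fixed-or-full
  }
  where
  tail-below : sum a < sum b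
  tail-below = +-cancelˡ-< q (sum a) (sum b) (≤-<-trans (+-monoˡ-≤ (sum a) (≮⇒≥ p≮q)) lt)
  open Raise (raise a b e tail-below 1≤e)
... | yes p<q with e ≤? q ∸ p
...   | yes e≤gap = record
  { δ             = e
  ; raised        = (p + e) ∷ a
  ; 1≤δ           = 1≤e
  ; δ≤e           = ≤-refl
  ; single-change = trans (hamming-∷-≢ (<⇒≢ (m<m+n p 1≤e))) (cong suc (hamming-refl a))
  ; sum-raised    = trans (+-assoc p e (sum a)) (x∙yz≈y∙xz p e (sum a))
  ; excess-kept   = cong (_+ excess a b) (trans (m≤n⇒m∸n≡0 p+e≤q) (sym (m≤n⇒m∸n≡0 (<⇒≤ p<q))))
  ; hamming-kept  = ≤-trans (hamming-∷-≤ (p + e) q a b) (≤-reflexive (sym (hamming-∷-≢ (<⇒≢ p<q))))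
  ; fixed-or-full = inj₂ refl
  }
  where
  p+e≤q : p + e ≤ q
  p+e≤q = subst (p + e ≤_) (m+[n∸m]≡n (<⇒≤ p<q)) (+-monoʳ-≤ p e≤gap)
...   | no e≰gap = record
  { δ             = q ∸ p
  ; raised        = q ∷ a
  ; 1≤δ           = m<n⇒0<n∸m p<q
  ; δ≤e           = <⇒≤ (≰⇒> e≰gap)
  ; single-change = trans (hamming-∷-≢ (<⇒≢ p<q)) (cong suc (hamming-refl a))
  ; sum-raised    = trans (cong (_+ sum a) (sym (m∸n+n≡m (<⇒≤ p<q)))) (+-assoc (q ∸ p) p (sum a))
  ; excess-kept   = cong (_+ excess a b) (trans (n∸n≡0 q) (sym (m≤n⇒m∸n≡0 (<⇒≤ p<q))))
  ; hamming-kept  = <⇒≤ head-fixed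
  ; fixed-or-full = inj₁ head-fixed
  }
  where
  head-fixed : hamming (q ∷ a) (q ∷ b) < hamming (p ∷ a) (q ∷ b)
  head-fixed = subst₂ _<_ (sym (hamming-∷-≡ q a b)) (sym (hamming-∷-≢ (<⇒≢ p<q))) ≤-refl

record Approach {k} (a b : Vec ℕ k) : Set where
  field
    next          : Vec ℕ k
    sum-next      : sum next ≡ sum a
    edge          : hamming a next ≡ 2
    far           : 2 ≤ hamming a b
    hamming-drops : hamming next b < hamming a b
    excess-drops  : excess next b < excess a b

approach-∷ : ∀ {k} x {a b : Vec ℕ k} → Approach a b → Approach (x ∷ a) (x ∷ b)
approach-∷ x {a} {b} towards = record
  { next          = x ∷ next
  ; sum-next      = cong (x +_) sum-next
  ; edge          = trans (hamming-∷-≡ x a next) edge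
  ; far           = subst (2 ≤_) (sym (hamming-∷-≡ x a b)) far
  ; hamming-drops = hamming-∷-mono-< x x hamming-drops
  ; excess-drops  = subst (λ z → z + excess next b < z + excess a b) (sym (n∸n≡0 x)) excess-drops
  }
  where open Approach towards

-- If the head of a exceeds the head of b (and the sums agree), lower it and
-- move the surplus into the tail with 'raise'.
approach-head : ∀ {k} x y (a b : Vec ℕ k) → y < x → x + sum a ≡ y + sum b → Approach (x ∷ a) (y ∷ b)
approach-head x y a b y<x eq = record
  { next          = (x ∸ δ) ∷ raised
  ; sum-next      = mass-kept
  ; edge          = trans (hamming-∷-≢ (>⇒≢ (∸-monoʳ-< 1≤δ δ≤x))) (cong suc single-change)
  ; far           = subst (2 ≤_) (sym heads-differ) (s≤s (hamming-pos tails-differ))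
  ; hamming-drops = subst (hamming ((x ∸ δ) ∷ raised) (y ∷ b) <_) (sym heads-differ) (s≤s tail-step)
  ; excess-drops  = subst (λ z → (x ∸ δ ∸ y) + z < (x ∸ y) + excess a b) (sym excess-kept)
                      (+-monoˡ-< (excess a b) head-excess-drops)
  }
  where
  tail-below : sum a < sum b
  tail-below = +-cancelˡ-< y (sum a) (sum b) (subst (y + sum a <_) eq (+-monoˡ-< (sum a) y<x))
  tails-differ : a ≢ b
  tails-differ a≡b = <-irrefl (cong sum a≡b) tail-below
  open Raise (raise a b (x ∸ y) tail-below (m<n⇒0<n∸m y<x))
  δ≤x : δ ≤ x
  δ≤x = ≤-trans δ≤e (m∸n≤m x y)
  mass-kept : (x ∸ δ) + sum raised ≡ x + sum a
  mass-kept = begin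
    (x ∸ δ) + sum raised   ≡⟨ cong ((x ∸ δ) +_) sum-raised ⟩
    (x ∸ δ) + (δ + sum a)  ≡⟨ sym (+-assoc (x ∸ δ) δ (sum a)) ⟩
    (x ∸ δ) + δ + sum a    ≡⟨ cong (_+ sum a) (m∸n+n≡m δ≤x) ⟩
    x + sum a              ∎
    where open ≡-Reasoning
  heads-differ : hamming (x ∷ a) (y ∷ b) ≡ suc (hamming a b)
  heads-differ = hamming-∷-≢ (>⇒≢ y<x)
  -- Either the tail got closer, or the full surplus was moved and the head is fixed.
  tail-step : hamming ((x ∸ δ) ∷ raised) (y ∷ b) ≤ hamming a b
  tail-step with fixed-or-full
  ... | inj₁ closer = ≤-trans (hamming-∷-≤ (x ∸ δ) y raised b) closer
  ... | inj₂ δ≡gap  = begin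
    hamming ((x ∸ δ) ∷ raised) (y ∷ b) ≡⟨ cong (λ z → hamming (z ∷ raised) (y ∷ b)) head-fixed ⟩
    hamming (y ∷ raised) (y ∷ b)       ≡⟨ hamming-∷-≡ y raised b ⟩
    hamming raised b                   ≤⟨ hamming-kept ⟩
    hamming a b                        ∎
    where
    open ≤-Reasoning
    head-fixed : x ∸ δ ≡ y
    head-fixed = trans (cong (x ∸_) δ≡gap) (m∸[m∸n]≡n (<⇒≤ y<x))
  head-excess-drops : x ∸ δ ∸ y < x ∸ y
  head-excess-drops = begin-strict
    x ∸ δ ∸ y   ≡⟨ ∸-+-assoc x δ y ⟩
    x ∸ (δ + y) ≡⟨ cong (x ∸_) (+-comm δ y) ⟩
    x ∸ (y + δ) ≡⟨ sym (∸-+-assoc x y δ) ⟩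
    x ∸ y ∸ δ   <⟨ ∸-monoʳ-< 1≤δ δ≤e ⟩
    x ∸ y       ∎
    where open ≤-Reasoning

-- Between distinct vectors of equal sum, one of them can approach the other:
-- the one with the larger entry at the first disagreement.
approach : ∀ {k} (a b : Vec ℕ k) → sum a ≡ sum b → a ≢ b → Approach a b ⊎ Approach b a
approach [] [] _ a≢b = contradiction refl a≢b
approach (x ∷ a) (y ∷ b) eq a≢b with <-cmp x y
... | tri< x<y _ _ = inj₂ (approach-head y x b a x<y (sym eq))
... | tri> _ _ y<x = inj₁ (approach-head x y a b y<x eq)
... | tri≈ _ refl _ with approach a b (+-cancelˡ-≡ x _ _ eq) (a≢b ∘ cong (x ∷_))
...   | inj₁ towards = inj₁ (approach-∷ x towards)
...   | inj₂ towards = inj₂ (approach-∷ x towards)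

vertex-≡ : ∀ {m n} {u v : Vertex m n} → proj₁ u ≡ proj₁ v → u ≡ v
vertex-≡ {u = a , p} {.a , q} refl = cong (a ,_) (≡-irrelevant p q)

stay : ∀ {m n} {u v : Vertex m n} → proj₁ u ≡ proj₁ v → Walk u v 0
stay {u = u} same = subst (λ v → Walk u v 0) (vertex-≡ same) here

snoc : ∀ {m n} {u w v : Vertex m n} {k} → Walk u w k → Adj w v → Walk u v (suc k)
snoc here       w~v = step w~v here
snoc (step e p) w~v = step e (snoc p w~v)

record ShortWalk {m n} (u v : Vertex m n) : Set where
  field
    len        : ℕ
    walk       : Walk u v len
    ≤hamming-1 : len ≤ hamming (proj₁ u) (proj₁ v) ∸ 1
    ≤excess    : len ≤ excess (proj₁ u) (proj₁ v)

hamming-bound-step : ∀ {k h' h} → k ≤ h' ∸ 1 → h' < h → 2 ≤ h → suc k ≤ h ∸ 1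
hamming-bound-step {h' = zero}  z≤n _ (s≤s (s≤s _)) = s≤s z≤n
hamming-bound-step {h' = suc _} k≤h' (s≤s h'<h) _ = ≤-trans (s≤s k≤h') h'<h

-- Every pair of vertices is joined by a short walk, by iterating 'approach'
-- from whichever endpoint can move; the fuel bounds the Hamming distance.
shortWalk : ∀ {m n} fuel (u v : Vertex m n) → hamming (proj₁ u) (proj₁ v) ≤ fuel → ShortWalk u v
shortWalk fuel (a , pa) (b , pb) h≤fuel with Vec.≡-dec _≟_ a b
... | yes refl = record { len = 0 ; walk = stay refl ; ≤hamming-1 = z≤n ; ≤excess = z≤n }
shortWalk zero (a , pa) (b , pb) h≤fuel | no a≢b =
  contradiction (hamming≡0⇒≡ a b (n≤0⇒n≡0 h≤fuel)) a≢b
shortWalk (suc fuel) (a , pa) (b , pb) h≤fuel | no a≢b with approach a b (trans pa (sym pb)) a≢b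
... | inj₁ towards-b = record
  { len        = suc len
  ; walk       = step edge walk
  ; ≤hamming-1 = hamming-bound-step ≤hamming-1 hamming-drops far
  ; ≤excess    = <-≤-trans (s≤s ≤excess) excess-drops
  }
  where
  open Approach towards-b
  open ShortWalk (shortWalk fuel (next , trans sum-next pa) (b , pb)
                   (≤-pred (<-≤-trans hamming-drops h≤fuel)))
... | inj₂ towards-a = record
  { len        = suc len
  ; walk       = snoc walk (trans (hamming-sym next b) edge)
  ; ≤hamming-1 = hamming-bound-step ≤hamming-1 hamming-drops′
                   (subst (2 ≤_) (hamming-sym b a) far)
  ; ≤excess    = <-≤-trans (s≤s ≤excess) excess-drops′
  }
  where
  open Approach towards-a
  hamming-drops′ : hamming a next < hamming a b
  hamming-drops′ = subst₂ _<_ (hamming-sym next a) (hamming-sym b a) hamming-drops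
  excess-drops′ : excess a next < excess a b
  excess-drops′ = subst₂ _<_ (excess-sym next a (trans (trans sum-next pb) (sym pa)))
                             (excess-sym b a (trans pb (sym pa))) excess-drops
  open ShortWalk (shortWalk fuel (a , pa) (next , trans sum-next pb)
                   (≤-pred (<-≤-trans hamming-drops′ h≤fuel)))

cons : ∀ {m n} (i : Fin (suc n)) → Vertex m (n ∸ toℕ i) → Vertex (suc m) n
cons {n = n} i (a , p) = (toℕ i ∷ a) , trans (cong (toℕ i +_) p) (m+[n∸m]≡n (toℕ≤pred[n] i))

uncons : ∀ {m n} (v : Vertex (suc m) n) → ∃[ i ] ∃[ w ] cons i w ≡ v
uncons {n = n} ((x ∷ a) , p) = i , (a , tail-sum) , vertex-≡ (cong (_∷ a) (toℕ-fromℕ< x<1+n))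
  where
  x<1+n : x < suc n
  x<1+n = s≤s (subst (x ≤_) p (m≤m+n x (sum a)))
  i : Fin (suc n)
  i = fromℕ< x<1+n
  tail-sum : sum a ≡ n ∸ toℕ i
  tail-sum = begin
    sum a               ≡⟨ sym (m+n∸m≡n x (sum a)) ⟩
    x + sum a ∸ x       ≡⟨ cong₂ _∸_ p (sym (toℕ-fromℕ< x<1+n)) ⟩
    n ∸ toℕ i           ∎
    where open ≡-Reasoning

-- SR(m, n) is finite, so existence of a vertex with a decidable property is decidable.
any-vertex? : ∀ m n {P : Vertex m n → Set} → (∀ v → Dec (P v)) → Dec (∃ P)
any-vertex? zero zero    P? with P? ([] , refl)
... | yes p = yes (_ , p)
... | no ¬p = no λ { (([] , refl) , p) → ¬p p }
any-vertex? zero (suc n) P? = no λ { (([] , ()) , _) }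
any-vertex? (suc m) n {P} P? =
  map′ (λ { (i , w , p) → cons i w , p })
       (λ { (v , p) → let (i , w , cons≡v) = uncons v in i , w , subst P (sym cons≡v) p })
       (any? λ i → any-vertex? m (n ∸ toℕ i) (P? ∘ cons i))

walk? : ∀ {m n} j (u v : Vertex m n) → Dec (Walk u v j)
walk? zero (a , pa) (b , pb) with Vec.≡-dec _≟_ a b
... | yes refl = yes (stay refl)
... | no a≢b   = no λ { here → a≢b refl }
walk? {m} {n} (suc j) u v =
  map′ (λ { (w , u~w , p) → step u~w p })
       (λ { (step u~w p) → _ , u~w , p })
       (any-vertex? m n (λ w → (hamming (proj₁ u) (proj₁ w) ≟ 2) ×-dec walk? j w v))

least : {P : ℕ → Set} → (∀ k → Dec (P k)) → ∀ k₀ → P k₀ →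
        ∃[ k ] (k ≤ k₀ × P k × (∀ j → j < k → ¬ P j))
least P? k₀ p with P? 0
... | yes p₀ = 0 , z≤n , p₀ , λ _ ()
least P? zero       p | no ¬p₀ = contradiction p ¬p₀
least {P} P? (suc k₀) p | no ¬p₀ with least (P? ∘ suc) k₀ p
... | k , k≤k₀ , pk , below = suc k , s≤s k≤k₀ , pk , none-below
  where
  none-below : ∀ j → j < suc k → ¬ P j
  none-below zero    _         = ¬p₀
  none-below (suc j) (s≤s j<k) = below j j<k

distance : ∀ {m n} (u v : Vertex m n) {k₀} → Walk u v k₀ → ∃[ k ] (k ≤ k₀ × Dist u v k)
distance u v {k₀} p = least (λ j → walk? j u v) k₀ p

-- A short walk in SR(m + 1, n) has length at most min(m, n), as h ≤ m + 1
-- and the excess is at most the coordinate sum n.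
shortWalk-bound : ∀ {m n} {u v : Vertex (suc m) n} (w : ShortWalk u v) → ShortWalk.len w ≤ m ⊓ n
shortWalk-bound {u = a , pa} {b , _} w =
  ⊓-glb (≤-trans ≤hamming-1 (∸-monoˡ-≤ 1 (hamming≤length a b)))
        (≤-trans ≤excess (subst (excess a b ≤_) pa (excess≤sum a b)))
  where open ShortWalk w

distance-upper : ∀ {m n} (u v : Vertex (suc m) n) → ∃[ k ] (k ≤ m ⊓ n × Dist u v k)
distance-upper u v =
  let short              = shortWalk _ u v ≤-refl
      (k , k≤len , dist) = distance u v (ShortWalk.walk short)
  in k , ≤-trans k≤len (shortWalk-bound short) , dist

nonzero : ℕ → ℕ
nonzero zero    = 0
nonzero (suc _) = 1

support : ∀ {k} → Vec ℕ k → ℕ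
support []      = 0
support (x ∷ a) = nonzero x + support a

rise : ℕ → ℕ → ℕ
rise _       zero    = 0
rise zero    (suc _) = 1
rise (suc x) (suc y) = rise x y

rises : ∀ {k} → Vec ℕ k → Vec ℕ k → ℕ
rises []      []      = 0
rises (x ∷ a) (y ∷ b) = rise x y + rises a b

nonzero-rise : ∀ x y → nonzero y ≤ rise x y + nonzero x
nonzero-rise x       zero    = z≤n
nonzero-rise zero    (suc y) = ≤-refl
nonzero-rise (suc x) (suc y) = m≤n+m 1 (rise x y)

support-rises : ∀ {k} (a b : Vec ℕ k) → support b ≤ rises a b + support a
support-rises []      []      = z≤n
support-rises (x ∷ a) (y ∷ b) =
  ≤-trans (+-mono-≤ (nonzero-rise x y) (support-rises a b))
          (≤-reflexive (interchange (rise x y) (nonzero x) (rises a b) (support a)))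

-- Each disagreement is a rise in exactly one direction, so
-- rises a b + rises b a = h(a, b).
rise-refl : ∀ x → rise x x ≡ 0
rise-refl zero    = refl
rise-refl (suc x) = rise-refl x

rise-distinct : ∀ {x y} → x ≢ y → rise x y + rise y x ≡ 1
rise-distinct {zero}  {zero}  0≢0 = contradiction refl 0≢0
rise-distinct {zero}  {suc y} _   = refl
rise-distinct {suc x} {zero}  _   = refl
rise-distinct {suc x} {suc y} x≢y = rise-distinct (x≢y ∘ cong suc)

rises-two-way : ∀ {k} (a b : Vec ℕ k) → rises a b + rises b a ≡ hamming a b
rises-two-way [] [] = refl
rises-two-way (x ∷ a) (y ∷ b) = begin
  rise x y + rises a b + (rise y x + rises b a)  ≡⟨ interchange (rise x y) (rises a b) (rise y x) (rises b a) ⟩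
  rise x y + rise y x + (rises a b + rises b a)  ≡⟨ cong (rise x y + rise y x +_) (rises-two-way a b) ⟩
  rise x y + rise y x + hamming a b              ≡⟨ heads x y ⟩
  hamming (x ∷ a) (y ∷ b)                        ∎
  where
  open ≡-Reasoning
  heads : ∀ x y → rise x y + rise y x + hamming a b ≡ hamming (x ∷ a) (y ∷ b)
  heads x y with x ≟ y
  ... | yes refl = cong (λ r → r + r + hamming a b) (rise-refl x)
  ... | no x≢y   = cong (_+ hamming a b) (rise-distinct x≢y)

no-rises⇒no-excess : ∀ {k} (a b : Vec ℕ k) → rises a b ≡ 0 → excess b a ≡ 0
no-rises⇒no-excess [] [] _ = refl
no-rises⇒no-excess (x ∷ a) (y ∷ b) r≡0 =
  cong₂ _+_ (head x y (m+n≡0⇒m≡0 (rise x y) r≡0)) (no-rises⇒no-excess a b (m+n≡0⇒n≡0 (rise x y) r≡0))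
  where
  head : ∀ x y → rise x y ≡ 0 → y ∸ x ≡ 0
  head x       zero    _ = 0∸n≡0 x
  head zero    (suc y) ()
  head (suc x) (suc y) r = head x y r

no-excess⇒≡ : ∀ {k} (a b : Vec ℕ k) → excess a b ≡ 0 → excess b a ≡ 0 → a ≡ b
no-excess⇒≡ [] [] _ _ = refl
no-excess⇒≡ (x ∷ a) (y ∷ b) eab eba = cong₂ _∷_
  (≤-antisym (m∸n≡0⇒m≤n (m+n≡0⇒m≡0 (x ∸ y) eab)) (m∸n≡0⇒m≤n (m+n≡0⇒m≡0 (y ∸ x) eba)))
  (no-excess⇒≡ a b (m+n≡0⇒n≡0 (x ∸ y) eab) (m+n≡0⇒n≡0 (y ∸ x) eba))

some-rise : ∀ {k} (a b : Vec ℕ k) → sum a ≡ sum b → a ≢ b → 1 ≤ rises a b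
some-rise a b eq a≢b = n≢0⇒n>0 λ r≡0 →
  let eba = no-rises⇒no-excess a b r≡0 in
  a≢b (no-excess⇒≡ a b (trans (excess-sym a b eq) eba) eba)

-- Along an edge at most one coordinate rises: only two coordinates change, and
-- with the sum fixed one of them must fall.
rises-adjacent : ∀ {k} (a b : Vec ℕ k) → hamming a b ≡ 2 → sum a ≡ sum b → rises a b ≤ 1
rises-adjacent a b h≡2 eq =
  +-cancelʳ-≤ 1 (rises a b) 1
    (subst (rises a b + 1 ≤_) (trans (rises-two-way a b) h≡2) (+-monoʳ-≤ (rises a b) fall))
  where
  a≢b : a ≢ b
  a≢b refl = contradiction (trans (sym (hamming-refl a)) h≡2) (λ ())
  fall : 1 ≤ rises b a
  fall = some-rise b a (sym eq) (a≢b ∘ sym)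

walk-support : ∀ {m n} {u v : Vertex (suc m) n} {k} → Walk u v k →
               support (tail (proj₁ v)) ≤ k + support (tail (proj₁ u))
walk-support here = ≤-refl
walk-support {u = (x ∷ a) , pa} {v} {suc k} (step {w = (y ∷ b) , pb} u~w p) = begin
  support (tail (proj₁ v))       ≤⟨ walk-support p ⟩
  k + support b                  ≤⟨ +-monoʳ-≤ k (support-rises a b) ⟩
  k + (rises a b + support a)    ≤⟨ +-monoʳ-≤ k (+-monoˡ-≤ (support a) tail-rises≤1) ⟩
  k + suc (support a)            ≡⟨ +-suc k (support a) ⟩
  suc k + support a              ∎
  where
  open ≤-Reasoning
  tail-rises≤1 : rises a b ≤ 1
  tail-rises≤1 = ≤-trans (m≤n+m (rises a b) (rise x y)) (rises-adjacent (x ∷ a) (y ∷ b) u~w (trans pa (sym pb)))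

ones : ∀ k → ℕ → Vec ℕ k
ones zero    _       = []
ones (suc k) zero    = 0 ∷ ones k 0
ones (suc k) (suc d) = 1 ∷ ones k d

ones-sum : ∀ k d → sum (ones k d) ≡ k ⊓ d
ones-sum zero    _       = refl
ones-sum (suc k) zero    = trans (ones-sum k 0) (⊓-zeroʳ k)
ones-sum (suc k) (suc d) = cong suc (ones-sum k d)

ones-support : ∀ k d → support (ones k d) ≡ k ⊓ d
ones-support zero    _       = refl
ones-support (suc k) zero    = trans (ones-support k 0) (⊓-zeroʳ k)
ones-support (suc k) (suc d) = cong suc (ones-support k d)

-- The extremal pair: (n, 0, …, 0) and (n - d, 1, …, 1, 0, …, 0) with d = min(m, n) ones.
corner : ∀ m n → Vertex (suc m) n
corner m n = (n ∷ ones m 0) , trans (cong (n +_) (trans (ones-sum m 0) (⊓-zeroʳ m))) (+-identityʳ n)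

spread : ∀ m n → Vertex (suc m) n
spread m n = ((n ∸ m ⊓ n) ∷ ones m n) , trans (cong ((n ∸ m ⊓ n) +_) (ones-sum m n)) (m∸n+n≡m (m⊓n≤n m n))

-- The tail support grows from 0 to min(m, n), so the extremal pair is min(m, n) apart.
corner-spread-far : ∀ {m n k} → Walk (corner m n) (spread m n) k → m ⊓ n ≤ k
corner-spread-far {m} {n} {k} p =
  subst₂ _≤_ (ones-support m n)
             (trans (cong (k +_) (trans (ones-support m 0) (⊓-zeroʳ m))) (+-identityʳ k))
             (walk-support p)

diameter : ∀ {m n d} → (∀ u v → ∃[ k ] (k ≤ d × Dist {m} {n} u v k)) →
           (u v : Vertex m n) → (∀ {k} → Walk u v k → d ≤ k) → HasDiameter m n d
diameter upper u v far with upper u v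
... | k , k≤d , dist = upper , u , v , subst (Dist u v) (≤-antisym k≤d (far (proj₁ dist))) dist

mainTheorem7 : (m n : ℕ) → m > 0 → HasDiameter m n ((m ∸ 1) ⊓ n)
mainTheorem7 zero    n ()
mainTheorem7 (suc m) n _ = diameter distance-upper (corner m n) (spread m n) corner-spread-far
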